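{- For every integer $\ell\geq 2$ there exists an integer $n\in\left[2\ell-1,\frac{\ell(3\ell-1)}{2}\right]$ such that $\sigma moex(n)$ is odd. Consequently, there are infinitely many integers $n$ for which $\sigma moex(n)$ is odd.
   Context: For a partition $\pi$ of a positive integer $n$, $moex(\pi)$ is the smallest odd positive integer that is not a part of $\pi$. For a positive integer $n$, $\sigma moex(n)=\sum_{\pi} moex(\pi)$, summed over all partitions $\pi$ of $n$, and $\sigma moex(0)=1$. Equivalently, $\sum_{n\geq 0}\sigma moex(n)q^n=(-q;q)_\infty(-q;q^2)_\infty^2$, where $(a;q)_\infty=\prod_{m\geq 1}(1-aq^{m-1})$. -}

module Defs where

open import Data.Nat using (ℕ; zero; suc; _+_; _*_; _∸_; _≤ᵇ_; _≡ᵇ_)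
open import Data.Bool using (Bool; true; false; if_then_else_; _∨_)
open import Data.List using (List; []; _∷_; [_]; _++_; map; concatMap; replicate; upTo; length)
open import Data.Nat.ListAction using (sum)

_∈ᵇ_ : ℕ → List ℕ → Bool
x ∈ᵇ [] = false
x ∈ᵇ (y ∷ ys) = (x ≡ᵇ y) ∨ (x ∈ᵇ ys)

-- A partition is represented as a list of its parts (non-increasing).
-- parts n k : all partitions of n whose parts lie in {1,...,k}, each exactly once.
parts : ℕ → ℕ → List (List ℕ)
parts zero    zero    = [ [] ]
parts (suc n) zero    = []
parts n       (suc j) =
  concatMap (λ m → if m * suc j ≤ᵇ n
                     then map (replicate m (suc j) ++_) (parts (n ∸ m * suc j) j)
                     else [])
            (upTo (suc n))

partitions : ℕ → List (List ℕ)
partitions n = parts n n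

moexAux : ℕ → ℕ → List ℕ → ℕ
moexAux zero    i π = 1 + 2 * i
moexAux (suc f) i π = if (1 + 2 * i) ∈ᵇ π then moexAux f (suc i) π else 1 + 2 * i

-- moex(π): smallest odd positive integer that is not a part of π.
-- Fuel length π suffices: at most length π odd numbers occur in π.
moex : List ℕ → ℕ
moex π = moexAux (length π) 0 π

-- σmoex(n) = Σ_{π ⊢ n} moex(π); for n = 0 the only partition is the empty
-- one with moex = 1, matching σmoex(0) = 1.
σmoex : ℕ → ℕ
σmoex n = sum (map moex (partitions n))

module Submission where

-- Every moex value is odd, so σmoex(n) ≡ p(n) (mod 2). Over 𝔽₂ the generating
-- function P_N of partitions into parts ≤ N satisfies (1 + q)(1 + q²)⋯(1 + q^N) P_N = 1,
-- and Shanks' finite form of Euler's pentagonal number theorem says that in degrees ≤ N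
-- the product (1 + q)⋯(1 + q^N) agrees with 1 + Σ_{k ≤ N} (q^{k(3k−1)/2} + q^{k(3k+1)/2}).
-- At the pentagonal number N = ℓ(3ℓ−1)/2 this gives Σ_ω p(N − ω) ≡ 0 over the
-- generalized pentagonal numbers ω ≤ N. The term ω = N is p(0) = 1, so p(N − ω) is odd
-- for some ω ≤ (ℓ−1)(3ℓ−2)/2, that is, for some N − ω ≥ 2ℓ − 1.

open import Defs
open import Data.Nat
open import Data.Nat.Properties
open import Data.Nat.DivMod using (m*n/n≡m)
open import Data.Nat.ListAction using (sum)
open import Data.Nat.Tactic.RingSolver using (solve-∀)
open import Data.Bool using (Bool; true; false; not; _xor_; if_then_else_; T)
open import Data.Bool.Properties
  using ( not-involutive; not-injective; not-distribˡ-xor; ¬-not; xor-same; xor-comm; xor-assoc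
        ; xor-identityʳ; if-float; xor-∧-commutativeRing )
open import Data.List using (List; []; _∷_; _++_; map; concatMap; replicate; upTo; applyUpTo; length)
open import Data.List.Properties using (length-++; length-map; map-applyUpTo)
open import Data.Product using (_×_; _,_; ∃-syntax)
open import Data.Sum using (_⊎_; inj₁; inj₂)
open import Data.Unit using (tt)
open import Function using (id; _∘_)
open import Relation.Nullary using (yes; no)
open import Relation.Binary.PropositionalEquality
  using (_≡_; refl; sym; trans; cong; cong₂; subst; module ≡-Reasoning)
open import Algebra.Bundles using (AbelianGroup; CommutativeRing)
import Algebra.Construct.Pointwise as Pointwise
import Algebra.Properties.CommutativeSemigroup as CommutativeSemigroupProperties
import Relation.Binary.Reasoning.Setoid as SetoidReasoning

odd : ℕ → Bool
odd zero    = false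
odd (suc n) = not (odd n)

odd-+ : ∀ m n → odd (m + n) ≡ odd m xor odd n
odd-+ zero    n = refl
odd-+ (suc m) n = trans (cong not (odd-+ m n)) (not-distribˡ-xor (odd m) (odd n))

odd-2* : ∀ i → odd (2 * i) ≡ false
odd-2* i = trans (odd-+ i (i + 0)) (trans (cong (λ j → odd i xor odd j) (+-identityʳ i)) (xor-same (odd i)))

odd⇒%2≡1 : ∀ n → odd n ≡ true → n % 2 ≡ 1
odd⇒%2≡1 (suc zero)    _       = refl
odd⇒%2≡1 (suc (suc n)) odd-2+n = odd⇒%2≡1 n (trans (sym (not-involutive (odd n))) odd-2+n)

odd-sum : ∀ {A : Set} (g : A → ℕ) → (∀ x → odd (g x) ≡ true) →
          ∀ xs → odd (sum (map g xs)) ≡ odd (length xs)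
odd-sum g odd-g []       = refl
odd-sum g odd-g (x ∷ xs) = trans (odd-+ (g x) _) (cong₂ _xor_ (odd-g x) (odd-sum g odd-g xs))

xor-true : ∀ {x y} → x xor y ≡ true → x ≡ true ⊎ y ≡ true
xor-true {true}  _  = inj₁ refl
xor-true {false} eq = inj₂ eq

xor-cancelʳ : ∀ x y → (x xor y) xor y ≡ x
xor-cancelʳ x y = trans (xor-assoc x y y) (trans (cong (x xor_) (xor-same y)) (xor-identityʳ x))

sum-applyUpTo-cong : ∀ {g h : ℕ → ℕ} M → (∀ c → g c ≡ h c) →
                     sum (applyUpTo g M) ≡ sum (applyUpTo h M)
sum-applyUpTo-cong zero    g≗h = refl
sum-applyUpTo-cong (suc M) g≗h = cong₂ _+_ (g≗h 0) (sum-applyUpTo-cong M (g≗h ∘ suc))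

sum-applyUpTo-zero : ∀ h M → (∀ c → h c ≡ 0) → sum (applyUpTo h M) ≡ 0
sum-applyUpTo-zero h zero    h≗0 = refl
sum-applyUpTo-zero h (suc M) h≗0 = cong₂ _+_ (h≗0 0) (sum-applyUpTo-zero (h ∘ suc) M (h≗0 ∘ suc))

sum-applyUpTo-trailing : ∀ N h → (∀ c → N ≤ c → h c ≡ 0) →
                         ∀ M → N ≤ M → sum (applyUpTo h M) ≡ sum (applyUpTo h N)
sum-applyUpTo-trailing zero    h h≗0 M       _         = sum-applyUpTo-zero h M (λ c → h≗0 c z≤n)
sum-applyUpTo-trailing (suc N) h h≗0 (suc M) (s≤s N≤M) =
  cong (h 0 +_) (sum-applyUpTo-trailing N (h ∘ suc) (λ c N≤c → h≗0 (suc c) (s≤s N≤c)) M N≤M)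

length-concatMap : ∀ {A B : Set} (g : A → List B) xs →
                   length (concatMap g xs) ≡ sum (map (length ∘ g) xs)
length-concatMap g []       = refl
length-concatMap g (x ∷ xs) = trans (length-++ (g x)) (cong (length (g x) +_) (length-concatMap g xs))

suc-≤ᵇ-suc : ∀ m n → (suc m ≤ᵇ suc n) ≡ (m ≤ᵇ n)
suc-≤ᵇ-suc zero    n = refl
suc-≤ᵇ-suc (suc m) n = refl

+-cancelˡ-≤ᵇ : ∀ a m n → (a + m ≤ᵇ a + n) ≡ (m ≤ᵇ n)
+-cancelˡ-≤ᵇ zero    m n = refl
+-cancelˡ-≤ᵇ (suc a) m n = trans (suc-≤ᵇ-suc (a + m) (a + n)) (+-cancelˡ-≤ᵇ a m n)

<⇒≤ᵇ≡false : ∀ {m n} → n < m → (m ≤ᵇ n) ≡ false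
<⇒≤ᵇ≡false {m} {n} n<m = ¬-not (λ m≤ᵇn → <⇒≱ n<m (≤ᵇ⇒≤ m n (subst T (sym m≤ᵇn) tt)))

-- multiplesSum a h n is the coefficient of qⁿ in H(q)/(1 − qᵃ), where H(q) = Σ h(n) qⁿ.
multipleTerm : ℕ → (ℕ → ℕ) → ℕ → ℕ → ℕ
multipleTerm a h n c = if c * a ≤ᵇ n then h (n ∸ c * a) else 0

multiplesSum : ℕ → (ℕ → ℕ) → ℕ → ℕ
multiplesSum a h n = sum (applyUpTo (multipleTerm a h n) (suc n))

multipleTerm-beyond : ∀ a h {n} c → n < c * a → multipleTerm a h n c ≡ 0
multipleTerm-beyond a h c n<ca rewrite <⇒≤ᵇ≡false n<ca = refl

multipleTerm-suc : ∀ a h r c → multipleTerm a h (a + r) (suc c) ≡ multipleTerm a h r c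
multipleTerm-suc a h r c =
  cong₂ (λ b m → if b then h m else 0) (+-cancelˡ-≤ᵇ a (c * a) r) ([m+n]∸[m+o]≡n∸o a r (c * a))

multiplesSum-below : ∀ a .{{_ : NonZero a}} h n → n < a → multiplesSum a h n ≡ h n
multiplesSum-below a h n n<a = trans (cong (h n +_) higher-terms-vanish) (+-identityʳ (h n))
  where
  higher-terms-vanish : sum (applyUpTo (multipleTerm a h n ∘ suc) n) ≡ 0
  higher-terms-vanish = sum-applyUpTo-zero _ n
    (λ c → multipleTerm-beyond a h (suc c) (<-≤-trans n<a (m≤m+n a (c * a))))

multiplesSum-step : ∀ a .{{_ : NonZero a}} h r →
                    multiplesSum a h (a + r) ≡ h (a + r) + multiplesSum a h r
multiplesSum-step a h r = cong (h (a + r) +_) (begin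
  sum (applyUpTo (multipleTerm a h (a + r) ∘ suc) (a + r))
    ≡⟨ sum-applyUpTo-cong (a + r) (multipleTerm-suc a h r) ⟩
  sum (applyUpTo (multipleTerm a h r) (a + r))
    ≡⟨ sum-applyUpTo-trailing (suc r) (multipleTerm a h r) beyond (a + r) (m<n+m r (>-nonZero⁻¹ a)) ⟩
  multiplesSum a h r ∎)
  where
  open ≡-Reasoning
  beyond : ∀ c → suc r ≤ c → multipleTerm a h r c ≡ 0
  beyond c r<c = multipleTerm-beyond a h c (<-≤-trans r<c (m≤m*n c a))

countParts : ℕ → ℕ → ℕ
countParts k n = length (parts n k)

withMultiplicity : ℕ → ℕ → ℕ → List (List ℕ)
withMultiplicity j n m =
  if m * suc j ≤ᵇ n then map (replicate m (suc j) ++_) (parts (n ∸ m * suc j) j) else []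

parts-suc : ∀ j n → parts n (suc j) ≡ concatMap (withMultiplicity j n) (upTo (suc n))
parts-suc j zero    = refl
parts-suc j (suc n) = refl

countParts-suc : ∀ j n → countParts (suc j) n ≡ multiplesSum (suc j) (countParts j) n
countParts-suc j n = begin
  length (parts n (suc j))                                 ≡⟨ cong length (parts-suc j n) ⟩
  length (concatMap (withMultiplicity j n) (upTo (suc n))) ≡⟨ length-concatMap (withMultiplicity j n) (upTo (suc n)) ⟩
  sum (map (length ∘ withMultiplicity j n) (upTo (suc n))) ≡⟨ cong sum (map-applyUpTo id (length ∘ withMultiplicity j n) (suc n)) ⟩
  sum (applyUpTo (length ∘ withMultiplicity j n) (suc n))  ≡⟨ sum-applyUpTo-cong (suc n) length-withMultiplicity ⟩
  multiplesSum (suc j) (countParts j) n                    ∎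
  where
  open ≡-Reasoning
  length-withMultiplicity : ∀ m → length (withMultiplicity j n m) ≡ multipleTerm (suc j) (countParts j) n m
  length-withMultiplicity m = trans (if-float length (m * suc j ≤ᵇ n))
    (cong (λ ℓ → if m * suc j ≤ᵇ n then ℓ else 0) (length-map _ (parts (n ∸ m * suc j) j)))

countParts-below : ∀ j n → n < suc j → countParts (suc j) n ≡ countParts j n
countParts-below j n n<j+1 = trans (countParts-suc j n) (multiplesSum-below (suc j) (countParts j) n n<j+1)

countParts-step : ∀ j r → countParts (suc j) (suc j + r) ≡ countParts j (suc j + r) + countParts (suc j) r
countParts-step j r = begin
  countParts (suc j) (suc j + r)                                   ≡⟨ countParts-suc j (suc j + r) ⟩
  multiplesSum (suc j) (countParts j) (suc j + r)                  ≡⟨ multiplesSum-step (suc j) (countParts j) r ⟩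
  countParts j (suc j + r) + multiplesSum (suc j) (countParts j) r ≡⟨ cong (countParts j (suc j + r) +_) (countParts-suc j r) ⟨
  countParts j (suc j + r) + countParts (suc j) r                  ∎
  where open ≡-Reasoning

countParts-stable : ∀ n d → countParts (n + d) n ≡ countParts n n
countParts-stable n zero    = cong (λ k → countParts k n) (+-identityʳ n)
countParts-stable n (suc d) = begin
  countParts (n + suc d) n   ≡⟨ cong (λ k → countParts k n) (+-suc n d) ⟩
  countParts (suc (n + d)) n ≡⟨ countParts-below (n + d) n (s≤s (m≤m+n n d)) ⟩
  countParts (n + d) n       ≡⟨ countParts-stable n d ⟩
  countParts n n             ∎
  where open ≡-Reasoning

odd-moexAux : ∀ fuel i π → odd (moexAux fuel i π) ≡ true
odd-moexAux zero       i π = cong not (odd-2* i)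
odd-moexAux (suc fuel) i π with (1 + 2 * i) ∈ᵇ π
... | true  = odd-moexAux fuel (suc i) π
... | false = cong not (odd-2* i)

odd-σmoex : ∀ n → odd (σmoex n) ≡ odd (countParts n n)
odd-σmoex n = odd-sum moex (λ π → odd-moexAux (length π) 0 π) (partitions n)

-- Power series over 𝔽₂

Series : Set
Series = ℕ → Bool

⊕-abelianGroup : AbelianGroup _ _
⊕-abelianGroup = Pointwise.abelianGroup ℕ (CommutativeRing.+-abelianGroup xor-∧-commutativeRing)

open AbelianGroup ⊕-abelianGroup
  using (_≈_; setoid; ε; ∙-cong; assoc; comm; identityˡ; inverseʳ; commutativeSemigroup)
  renaming (_∙_ to _⊕_; sym to ≈-sym)
open CommutativeSemigroupProperties commutativeSemigroup using (interchange; xy∙z≈zx∙y)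

-- ∙-congˡ and ∙-congʳ with the fixed summand explicit: through the pointwise
-- equality Agda cannot infer it.
⊕-congˡ : ∀ f {g h} → g ≈ h → f ⊕ g ≈ f ⊕ h
⊕-congˡ f g≈h n = cong (f n xor_) (g≈h n)

⊕-congʳ : ∀ {f g} h → f ≈ g → f ⊕ h ≈ g ⊕ h
⊕-congʳ h f≈g n = cong (_xor h n) (f≈g n)

⊕-cancelˡ : ∀ f g → f ⊕ (f ⊕ g) ≈ g
⊕-cancelˡ f g n = trans (sym (xor-assoc (f n) (f n) (g n))) (cong (_xor g n) (xor-same (f n)))

⊕-cancelʳ : ∀ f g → (f ⊕ g) ⊕ g ≈ f
⊕-cancelʳ f g n = xor-cancelʳ (f n) (g n)

infixr 8 q^_·_ [1+q^_]·_

q^_·_ : ℕ → Series → Series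
(q^ zero  · f) n       = f n
(q^ suc a · f) zero    = false
(q^ suc a · f) (suc n) = (q^ a · f) n

[1+q^_]·_ : ℕ → Series → Series
[1+q^ a ]· f = f ⊕ q^ a · f

q^-cong : ∀ a {f g} → f ≈ g → q^ a · f ≈ q^ a · g
q^-cong zero    f≈g n       = f≈g n
q^-cong (suc a) f≈g zero    = refl
q^-cong (suc a) f≈g (suc n) = q^-cong a f≈g n

q^-⊕ : ∀ a f g → q^ a · (f ⊕ g) ≈ q^ a · f ⊕ q^ a · g
q^-⊕ zero    f g n       = refl
q^-⊕ (suc a) f g zero    = refl
q^-⊕ (suc a) f g (suc n) = q^-⊕ a f g n

q^-+ : ∀ a b f → q^ a · q^ b · f ≈ q^ (a + b) · f
q^-+ zero    b f n       = refl
q^-+ (suc a) b f zero    = refl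
q^-+ (suc a) b f (suc n) = q^-+ a b f n

q^-comm : ∀ a b f → q^ a · q^ b · f ≈ q^ b · q^ a · f
q^-comm a b f n =
  trans (q^-+ a b f n) (trans (cong (λ c → (q^ c · f) n) (+-comm a b)) (sym (q^-+ b a f n)))

q^-below : ∀ a f {n} → n < a → (q^ a · f) n ≡ false
q^-below (suc a) f {zero}  _         = refl
q^-below (suc a) f {suc n} (s≤s n<a) = q^-below a f n<a

q^-offset : ∀ a f r → (q^ a · f) (a + r) ≡ f r
q^-offset zero    f r = refl
q^-offset (suc a) f r = q^-offset a f r

q^-∸ : ∀ a f {n} → a ≤ n → (q^ a · f) n ≡ f (n ∸ a)
q^-∸ a f {n} a≤n = trans (cong (q^ a · f) (sym (m+[n∸m]≡n a≤n))) (q^-offset a f (n ∸ a))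

q^-witness : ∀ f {a c n} → c + a ≤ n → (q^ a · f) n ≡ true → ∃[ m ] (c ≤ m × m ≤ n × f m ≡ true)
q^-witness f {a} {c} {n} c+a≤n eq =
  n ∸ a , m+n≤o⇒m≤o∸n c c+a≤n , m∸n≤m n a , trans (sym (q^-∸ a f (m+n≤o⇒n≤o c c+a≤n))) eq

≈-split : ∀ a {f g : Series} → (∀ n → n < a → f n ≡ g n) → (∀ r → f (a + r) ≡ g (a + r)) → f ≈ g
≈-split a {f} {g} below offset n with n <? a
... | yes n<a = below n n<a
... | no  n≮a = subst (λ m → f m ≡ g m) (m+[n∸m]≡n (≮⇒≥ n≮a)) (offset (n ∸ a))

[1+q^]-cong : ∀ a {f g} → f ≈ g → [1+q^ a ]· f ≈ [1+q^ a ]· g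
[1+q^]-cong a f≈g = ∙-cong f≈g (q^-cong a f≈g)

[1+q^]-⊕ : ∀ a f g → [1+q^ a ]· (f ⊕ g) ≈ [1+q^ a ]· f ⊕ [1+q^ a ]· g
[1+q^]-⊕ a f g n =
  trans (cong ((f ⊕ g) n xor_) (q^-⊕ a f g n)) (interchange f g (q^ a · f) (q^ a · g) n)

[1+q^]-q^ : ∀ a b f → [1+q^ a ]· q^ b · f ≈ q^ b · [1+q^ a ]· f
[1+q^]-q^ a b f n =
  trans (cong ((q^ b · f) n xor_) (q^-comm a b f n)) (sym (q^-⊕ b f (q^ a · f) n))

-- (−q^{k+1}; q)_d, which over 𝔽₂ is also (q^{k+1}; q)_d
qPoch : ℕ → ℕ → Series → Series
qPoch k zero    f = f
qPoch k (suc d) f = [1+q^ suc k ]· qPoch (suc k) d f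

qPoch-⊕ : ∀ k d f g → qPoch k d (f ⊕ g) ≈ qPoch k d f ⊕ qPoch k d g
qPoch-⊕ k zero    f g n = refl
qPoch-⊕ k (suc d) f g n =
  trans ([1+q^]-cong (suc k) (qPoch-⊕ (suc k) d f g) n) ([1+q^]-⊕ (suc k) (qPoch (suc k) d f) _ n)

qPoch-q^ : ∀ k d a f → qPoch k d (q^ a · f) ≈ q^ a · qPoch k d f
qPoch-q^ k zero    a f n = refl
qPoch-q^ k (suc d) a f n =
  trans ([1+q^]-cong (suc k) (qPoch-q^ (suc k) d a f) n) ([1+q^]-q^ (suc k) a (qPoch (suc k) d f) n)

qPoch-[1+q^] : ∀ k d a f → qPoch k d ([1+q^ a ]· f) ≈ [1+q^ a ]· qPoch k d f
qPoch-[1+q^] k d a f n =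
  trans (qPoch-⊕ k d f (q^ a · f) n) (cong (qPoch k d f n xor_) (qPoch-q^ k d a f n))

qPoch-snoc : ∀ k d f → qPoch k (suc d) f ≈ qPoch k d ([1+q^ suc (k + d) ]· f)
qPoch-snoc k zero    f rewrite +-identityʳ k = λ n → refl
qPoch-snoc k (suc d) f rewrite +-suc k d     = [1+q^]-cong (suc k) (qPoch-snoc (suc k) d f)

partitionSeries : ℕ → Series
partitionSeries k = odd ∘ countParts k

partitionSeries-step : ∀ j → [1+q^ suc j ]· partitionSeries (suc j) ≈ partitionSeries j
partitionSeries-step j = ≈-split (suc j) below offset
  where
  below : ∀ n → n < suc j → ([1+q^ suc j ]· partitionSeries (suc j)) n ≡ partitionSeries j n
  below n n<j+1 = trans (cong₂ _xor_ (cong odd (countParts-below j n n<j+1))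
                                     (q^-below (suc j) (partitionSeries (suc j)) n<j+1))
                        (xor-identityʳ _)
  offset : ∀ r → ([1+q^ suc j ]· partitionSeries (suc j)) (suc j + r) ≡ partitionSeries j (suc j + r)
  offset r = begin
    odd (countParts (suc j) (suc j + r)) xor (q^ suc j · partitionSeries (suc j)) (suc j + r)
      ≡⟨ cong₂ _xor_ (cong odd (countParts-step j r)) (q^-offset (suc j) (partitionSeries (suc j)) r) ⟩
    odd (countParts j (suc j + r) + countParts (suc j) r) xor odd (countParts (suc j) r)
      ≡⟨ cong (_xor odd (countParts (suc j) r)) (odd-+ (countParts j (suc j + r)) (countParts (suc j) r)) ⟩
    (odd (countParts j (suc j + r)) xor odd (countParts (suc j) r)) xor odd (countParts (suc j) r)
      ≡⟨ xor-cancelʳ _ _ ⟩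
    odd (countParts j (suc j + r)) ∎
    where open ≡-Reasoning

qPoch-partitionSeries : ∀ k d → qPoch k d (partitionSeries (k + d)) ≈ partitionSeries k
qPoch-partitionSeries k zero    n = cong (λ j → partitionSeries j n) (+-identityʳ k)
qPoch-partitionSeries k (suc d) n rewrite +-suc k d =
  trans ([1+q^]-cong (suc k) (qPoch-partitionSeries (suc k) d) n) (partitionSeries-step k n)

-- Shanks' identity modulo 2

triangular : ℕ → ℕ
triangular zero    = 0
triangular (suc k) = triangular k + suc k

-- pent⁻ i and pent⁺ i are the pentagonal numbers k(3k − 1)/2 and k(3k + 1)/2 for k = i + 1.
pent⁻ pent⁺ : ℕ → ℕ
pent⁻ i = suc i * suc i + triangular i
pent⁺ i = suc i * suc i + triangular (suc i)

shanksExp : ℕ → ℕ → ℕ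
shanksExp k d = k * (k + d) + triangular k

shanksExp-suc : ∀ k d → shanksExp k (suc d) ≡ k + shanksExp k d
shanksExp-suc k d = arith k d (triangular k)
  where
  arith : ∀ k d t → k * (k + suc d) + t ≡ k + (k * (k + d) + t)
  arith = solve-∀

shanksExp-pent⁻ : ∀ k → shanksExp k 1 + suc (k + 0) ≡ pent⁻ k
shanksExp-pent⁻ k = arith k (triangular k)
  where
  arith : ∀ k t → k * (k + 1) + t + suc (k + 0) ≡ suc k * suc k + t
  arith = solve-∀

shanksExp-pent⁺ : ∀ k → shanksExp (suc k) 0 ≡ pent⁺ k
shanksExp-pent⁺ k = cong (λ j → suc k * j + triangular (suc k)) (+-identityʳ (suc k))

shanksExp-shift : ∀ k d → shanksExp k (suc (suc d)) + suc (k + suc d) ≡ shanksExp (suc k) d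
shanksExp-shift k d = arith k d (triangular k)
  where
  arith : ∀ k d t → k * (k + suc (suc d)) + t + suc (k + suc d) ≡ suc k * (suc k + d) + (t + suc k)
  arith = solve-∀

shanksExp-large : ∀ k d → suc k + d < shanksExp (suc k) d
shanksExp-large k d =
  <-≤-trans (m<m+n (suc k + d) (<-≤-trans z<s (m≤n+m (suc k) (triangular k))))
            (+-monoˡ-≤ (triangular (suc k)) (m≤n*m (suc k + d) (suc k)))

module _ (f : Series) where

  shanksTerm : ℕ → ℕ → Series
  shanksTerm k d = q^ shanksExp k d · qPoch k d f

  -- shanksSum 0 n = Σ_{i ≤ n} q^{i n + i(i+1)/2} (q^{i+1}; q)_{n−i} · f, the left-hand
  -- side of Shanks' identity; the extra index k makes the induction go through.
  shanksSum : ℕ → ℕ → Series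
  shanksSum k zero    = shanksTerm k zero
  shanksSum k (suc d) = shanksTerm k (suc d) ⊕ shanksSum (suc k) d

  pentagonalPair : ℕ → Series
  pentagonalPair i = q^ pent⁻ i · f ⊕ q^ pent⁺ i · f

  pentagonalSum : ℕ → Series
  pentagonalSum zero    = f
  pentagonalSum (suc n) = pentagonalSum n ⊕ pentagonalPair n

  open SetoidReasoning setoid

  shanksTerm-suc : ∀ k d →
    shanksTerm k (suc d) ≈ q^ k · shanksTerm k d ⊕ q^ (shanksExp k (suc d) + suc (k + d)) · qPoch k d f
  shanksTerm-suc k d = begin
    q^ e · qPoch k (suc d) f                    ≈⟨ q^-cong e (qPoch-snoc k d f) ⟩
    q^ e · qPoch k d ([1+q^ s ]· f)             ≈⟨ q^-cong e (qPoch-[1+q^] k d s f) ⟩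
    q^ e · (P ⊕ q^ s · P)                       ≈⟨ q^-⊕ e P (q^ s · P) ⟩
    q^ e · P ⊕ q^ e · q^ s · P                  ≈⟨ ∙-cong (λ n → cong (λ c → (q^ c · P) n) (shanksExp-suc k d))
                                                          (q^-+ e s P) ⟩
    q^ (k + shanksExp k d) · P ⊕ q^ (e + s) · P ≈⟨ ⊕-congʳ (q^ (e + s) · P) (≈-sym (q^-+ k (shanksExp k d) P)) ⟩
    q^ k · shanksTerm k d ⊕ q^ (e + s) · P      ∎
    where
    e = shanksExp k (suc d)
    s = suc (k + d)
    P = qPoch k d f

  shanksTerm-one : ∀ k → shanksTerm k 1 ≈ q^ k · shanksTerm k 0 ⊕ q^ pent⁻ k · f
  shanksTerm-one k n =
    trans (shanksTerm-suc k 0 n) (cong (λ c → (q^ k · shanksTerm k 0) n xor (q^ c · f) n) (shanksExp-pent⁻ k))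

  shanksTerm-suc-suc : ∀ k d →
    shanksTerm k (suc (suc d)) ≈ q^ k · shanksTerm k (suc d) ⊕ [1+q^ suc k ]· shanksTerm (suc k) d
  shanksTerm-suc-suc k d = begin
    shanksTerm k (suc (suc d))
      ≈⟨ shanksTerm-suc k (suc d) ⟩
    q^ k · shanksTerm k (suc d) ⊕ q^ E · [1+q^ suc k ]· P
      ≈⟨ ⊕-congˡ (q^ k · shanksTerm k (suc d)) (≈-sym ([1+q^]-q^ (suc k) E P)) ⟩
    q^ k · shanksTerm k (suc d) ⊕ [1+q^ suc k ]· q^ E · P
      ≡⟨ cong (λ c → q^ k · shanksTerm k (suc d) ⊕ [1+q^ suc k ]· q^ c · P) (shanksExp-shift k d) ⟩
    q^ k · shanksTerm k (suc d) ⊕ [1+q^ suc k ]· shanksTerm (suc k) d ∎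
    where
    E = shanksExp k (suc (suc d)) + suc (k + suc d)
    P = qPoch (suc k) d f

  shanksSum-increment : ∀ d k →
    shanksSum k (suc d) ⊕ shanksSum k d ≈ [1+q^ k ]· shanksTerm k d ⊕ pentagonalPair (k + d)
  shanksSum-increment zero k = begin
    (shanksTerm k 1 ⊕ shanksTerm (suc k) 0) ⊕ X
      ≈⟨ ⊕-congʳ X (∙-cong (shanksTerm-one k) (λ n → cong (λ c → (q^ c · f) n) (shanksExp-pent⁺ k))) ⟩
    ((q^ k · X ⊕ q^ pent⁻ k · f) ⊕ q^ pent⁺ k · f) ⊕ X
      ≈⟨ ⊕-congʳ X (assoc (q^ k · X) (q^ pent⁻ k · f) (q^ pent⁺ k · f)) ⟩
    (q^ k · X ⊕ pentagonalPair k) ⊕ X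
      ≈⟨ xy∙z≈zx∙y (q^ k · X) (pentagonalPair k) X ⟩
    [1+q^ k ]· X ⊕ pentagonalPair k
      ≡⟨ cong (λ i → [1+q^ k ]· X ⊕ pentagonalPair i) (sym (+-identityʳ k)) ⟩
    [1+q^ k ]· X ⊕ pentagonalPair (k + 0) ∎
    where X = shanksTerm k 0
  shanksSum-increment (suc d) k = begin
    (shanksTerm k (suc (suc d)) ⊕ shanksSum (suc k) (suc d)) ⊕ (X ⊕ shanksSum (suc k) d)
      ≈⟨ interchange (shanksTerm k (suc (suc d))) (shanksSum (suc k) (suc d)) X (shanksSum (suc k) d) ⟩
    (shanksTerm k (suc (suc d)) ⊕ X) ⊕ (shanksSum (suc k) (suc d) ⊕ shanksSum (suc k) d)
      ≈⟨ ∙-cong (⊕-congʳ X (shanksTerm-suc-suc k d)) (shanksSum-increment d (suc k)) ⟩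
    ((q^ k · X ⊕ P) ⊕ X) ⊕ (P ⊕ B)
      ≈⟨ ⊕-congʳ (P ⊕ B) (xy∙z≈zx∙y (q^ k · X) P X) ⟩
    ([1+q^ k ]· X ⊕ P) ⊕ (P ⊕ B)
      ≈⟨ assoc ([1+q^ k ]· X) P (P ⊕ B) ⟩
    [1+q^ k ]· X ⊕ (P ⊕ (P ⊕ B))
      ≈⟨ ⊕-congˡ ([1+q^ k ]· X) (⊕-cancelˡ P B) ⟩
    [1+q^ k ]· X ⊕ B
      ≡⟨ cong (λ i → [1+q^ k ]· X ⊕ pentagonalPair i) (sym (+-suc k d)) ⟩
    [1+q^ k ]· X ⊕ pentagonalPair (k + suc d) ∎
    where
    X = shanksTerm k (suc d)
    P = [1+q^ suc k ]· shanksTerm (suc k) d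
    B = pentagonalPair (suc k + d)

  shanksSum≈pentagonalSum : ∀ n → shanksSum 0 n ≈ pentagonalSum n
  shanksSum≈pentagonalSum zero    m = refl
  shanksSum≈pentagonalSum (suc n) = begin
    shanksSum 0 (suc n)
      ≈⟨ ⊕-cancelʳ (shanksSum 0 (suc n)) (shanksSum 0 n) ⟨
    (shanksSum 0 (suc n) ⊕ shanksSum 0 n) ⊕ shanksSum 0 n
      ≈⟨ ∙-cong (shanksSum-increment n 0) (shanksSum≈pentagonalSum n) ⟩
    ([1+q^ 0 ]· shanksTerm 0 n ⊕ pentagonalPair n) ⊕ pentagonalSum n
      ≈⟨ ⊕-congʳ (pentagonalSum n) (⊕-congʳ (pentagonalPair n) (inverseʳ (shanksTerm 0 n))) ⟩
    (ε ⊕ pentagonalPair n) ⊕ pentagonalSum n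
      ≈⟨ ⊕-congʳ (pentagonalSum n) (identityˡ (pentagonalPair n)) ⟩
    pentagonalPair n ⊕ pentagonalSum n
      ≈⟨ comm (pentagonalPair n) (pentagonalSum n) ⟩
    pentagonalSum (suc n) ∎

  shanksSum-vanishes : ∀ k d → shanksSum (suc k) d (suc k + d) ≡ false
  shanksSum-vanishes k zero    = q^-below _ _ (shanksExp-large k 0)
  shanksSum-vanishes k (suc d) =
    cong₂ _xor_ (q^-below _ _ (shanksExp-large k (suc d)))
                (trans (cong (shanksSum (suc (suc k)) d) (+-suc (suc k) d)) (shanksSum-vanishes (suc k) d))

  qPoch-coeff≡pentagonalSum-coeff : ∀ n → qPoch 0 n f n ≡ pentagonalSum n n
  qPoch-coeff≡pentagonalSum-coeff zero    = refl
  qPoch-coeff≡pentagonalSum-coeff (suc d) =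
    trans (sym (xor-identityʳ _))
          (trans (cong (qPoch 0 (suc d) f (suc d) xor_) (sym (shanksSum-vanishes 0 d)))
                 (shanksSum≈pentagonalSum (suc d) (suc d)))

triangular-mono-≤ : ∀ {m n} → m ≤ n → triangular m ≤ triangular n
triangular-mono-≤ z≤n       = z≤n
triangular-mono-≤ (s≤s m≤n) = +-mono-≤ (triangular-mono-≤ m≤n) (s≤s m≤n)

triangular-double : ∀ k → triangular k * 2 ≡ k * suc k
triangular-double zero    = refl
triangular-double (suc k) = begin
  (triangular k + suc k) * 2   ≡⟨ *-distribʳ-+ 2 (triangular k) (suc k) ⟩
  triangular k * 2 + suc k * 2 ≡⟨ cong (_+ suc k * 2) (triangular-double k) ⟩
  k * suc k + suc k * 2        ≡⟨ arith k ⟩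
  suc k * suc (suc k)          ∎
  where
  open ≡-Reasoning
  arith : ∀ k → k * suc k + suc k * 2 ≡ suc k * suc (suc k)
  arith = solve-∀

pent⁻<pent⁺ : ∀ i → pent⁻ i < pent⁺ i
pent⁻<pent⁺ i = +-monoʳ-< (suc i * suc i) (m<m+n (triangular i) z<s)

pent⁻-mono-≤ : ∀ {i j} → i ≤ j → pent⁻ i ≤ pent⁻ j
pent⁻-mono-≤ i≤j = +-mono-≤ (*-mono-≤ (s≤s i≤j) (s≤s i≤j)) (triangular-mono-≤ i≤j)

pent⁺-mono-≤ : ∀ {i j} → i ≤ j → pent⁺ i ≤ pent⁺ j
pent⁺-mono-≤ i≤j = +-mono-≤ (*-mono-≤ (s≤s i≤j) (s≤s i≤j)) (triangular-mono-≤ (s≤s i≤j))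

pent⁻-suc : ∀ i → pent⁻ (suc i) ≡ (2 * i + 3) + pent⁺ i
pent⁻-suc i = arith i (triangular i)
  where
  arith : ∀ i t → suc (suc i) * suc (suc i) + (t + suc i) ≡ (2 * i + 3) + (suc i * suc i + (t + suc i))
  arith = solve-∀

pent⁻<pent⁻-suc : ∀ i → pent⁻ i < pent⁻ (suc i)
pent⁻<pent⁻-suc i =
  <-≤-trans (pent⁻<pent⁺ i) (≤-trans (m≤n+m (pent⁺ i) (2 * i + 3)) (≤-reflexive (sym (pent⁻-suc i))))

pent⁻-closed-form : ∀ i → suc i * (3 * suc i ∸ 1) / 2 ≡ pent⁻ i
pent⁻-closed-form i = begin
  suc i * (3 * suc i ∸ 1) / 2 ≡⟨ cong (_/ 2) twice-pent⁻ ⟩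
  pent⁻ i * 2 / 2             ≡⟨ m*n/n≡m (pent⁻ i) 2 ⟩
  pent⁻ i                     ∎
  where
  open ≡-Reasoning
  arith : ∀ i → suc i * (i + (suc i + (suc i + 0))) ≡ (suc i * suc i) * 2 + i * suc i
  arith = solve-∀
  twice-pent⁻ : suc i * (3 * suc i ∸ 1) ≡ pent⁻ i * 2
  twice-pent⁻ = begin
    suc i * (3 * suc i ∸ 1)                ≡⟨ arith i ⟩
    (suc i * suc i) * 2 + i * suc i        ≡⟨ cong ((suc i * suc i) * 2 +_) (triangular-double i) ⟨
    (suc i * suc i) * 2 + triangular i * 2 ≡⟨ *-distribʳ-+ 2 (suc i * suc i) (triangular i) ⟨
    pent⁻ i * 2                            ∎

pentagonalSum-stable : ∀ f {n} d → n < pent⁻ d → ∀ e → pentagonalSum f (d + e) n ≡ pentagonalSum f d n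
pentagonalSum-stable f {n} d n<pent zero    = cong (λ j → pentagonalSum f j n) (+-identityʳ d)
pentagonalSum-stable f {n} d n<pent (suc e) = begin
  pentagonalSum f (d + suc e) n
    ≡⟨ cong (λ j → pentagonalSum f j n) (+-suc d e) ⟩
  pentagonalSum f (d + e) n xor ((q^ pent⁻ (d + e) · f) n xor (q^ pent⁺ (d + e) · f) n)
    ≡⟨ cong₂ _xor_ (pentagonalSum-stable f d n<pent e) (cong₂ _xor_ (q^-below _ f n<pent⁻) (q^-below _ f n<pent⁺)) ⟩
  pentagonalSum f d n xor false
    ≡⟨ xor-identityʳ _ ⟩
  pentagonalSum f d n ∎
  where
  open ≡-Reasoning
  n<pent⁻ = <-≤-trans n<pent (pent⁻-mono-≤ (m≤m+n d e))
  n<pent⁺ = <-trans n<pent⁻ (pent⁻<pent⁺ (d + e))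

pentagonalSum-witness : ∀ f {c n} d → c ≤ n → (∀ i → i < d → c + pent⁺ i ≤ n) →
                        pentagonalSum f d n ≡ true → ∃[ m ] (c ≤ m × m ≤ n × f m ≡ true)
pentagonalSum-witness f {c} {n} zero    c≤n _     fn≡true = n , c≤n , ≤-refl , fn≡true
pentagonalSum-witness f {c} {n} (suc d) c≤n bound sum≡true with xor-true sum≡true
... | inj₁ partial = pentagonalSum-witness f d c≤n (λ i i<d → bound i (m≤n⇒m≤1+n i<d)) partial
... | inj₂ pair with xor-true pair
...   | inj₁ minus = q^-witness f (≤-trans (+-monoʳ-≤ c (<⇒≤ (pent⁻<pent⁺ d))) (bound d ≤-refl)) minus
...   | inj₂ plus  = q^-witness f (bound d ≤-refl) plus

-- Partition numbers below a pentagonal number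

partitionSeries-coeff : ∀ {m N} → m ≤ N → partitionSeries N m ≡ odd (countParts m m)
partitionSeries-coeff {m} {N} m≤N =
  cong odd (trans (cong (λ k → countParts k m) (sym (m+[n∸m]≡n m≤N))) (countParts-stable m (N ∸ m)))

odd-countParts-below-pentagonal : ∀ l →
  ∃[ m ] (2 * l + 3 ≤ m × m ≤ pent⁻ (suc l) × odd (countParts m m) ≡ true)
odd-countParts-below-pentagonal l =
  let (m , c≤m , m≤N , fm≡true) = pentagonalSum-witness f (suc l) c≤N bound partial-sum-odd
  in  m , c≤m , m≤N , trans (sym (partitionSeries-coeff m≤N)) fm≡true
  where
  N = pent⁻ (suc l)
  c = 2 * l + 3
  f = partitionSeries N

  c≤N : c ≤ N
  c≤N = ≤-trans (m≤m+n c (pent⁺ l)) (≤-reflexive (sym (pent⁻-suc l)))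

  bound : ∀ i → i < suc l → c + pent⁺ i ≤ N
  bound i i<l+1 = ≤-trans (+-monoʳ-≤ c (pent⁺-mono-≤ (≤-pred i<l+1))) (≤-reflexive (sym (pent⁻-suc l)))

  full-sum-even : pentagonalSum f N N ≡ false
  full-sum-even = trans (sym (qPoch-coeff≡pentagonalSum-coeff f N)) (qPoch-partitionSeries 0 N N)

  full-sum≡truncated : pentagonalSum f N N ≡ pentagonalSum f (suc (suc l)) N
  full-sum≡truncated =
    trans (cong (λ d → pentagonalSum f d N) (sym (m+[n∸m]≡n l+2≤N)))
          (pentagonalSum-stable f (suc (suc l)) (pent⁻<pent⁻-suc (suc l)) (N ∸ suc (suc l)))
    where
    l+2≤N : suc (suc l) ≤ N
    l+2≤N = ≤-trans (m≤m*n (suc (suc l)) (suc (suc l))) (m≤m+n _ (triangular (suc l)))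

  last-pair : pentagonalSum f (suc (suc l)) N ≡ not (pentagonalSum f (suc l) N)
  last-pair = trans (cong (pentagonalSum f (suc l) N xor_) (cong₂ _xor_ at-N at-pent⁺)) (xor-comm _ true)
    where
    at-N : (q^ N · f) N ≡ true
    at-N = trans (q^-∸ N f ≤-refl) (trans (cong f (n∸n≡0 N)) (cong odd (countParts-stable 0 N)))
    at-pent⁺ : (q^ pent⁺ (suc l) · f) N ≡ false
    at-pent⁺ = q^-below (pent⁺ (suc l)) f (pent⁻<pent⁺ (suc l))

  partial-sum-odd : pentagonalSum f (suc l) N ≡ true
  partial-sum-odd = not-injective (trans (sym last-pair) (trans (sym full-sum≡truncated) full-sum-even))

lemma3p3 : ((ℓ : ℕ) → 2 ≤ ℓ →
               ∃[ n ] ((2 * ℓ ∸ 1 ≤ n) × (n ≤ (ℓ * (3 * ℓ ∸ 1)) / 2) × (σmoex n % 2 ≡ 1)))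
             × ((m : ℕ) → ∃[ n ] ((m ≤ n) × (σmoex n % 2 ≡ 1)))
lemma3p3 = odd-in-interval , unbounded
  where
  interval-start : ∀ l → 2 * suc (suc l) ∸ 1 ≡ 2 * l + 3
  interval-start l = arith l
    where
    arith : ∀ l → suc (l + suc (suc (l + 0))) ≡ 2 * l + 3
    arith = solve-∀

  odd-in-interval : (ℓ : ℕ) → 2 ≤ ℓ →
    ∃[ n ] ((2 * ℓ ∸ 1 ≤ n) × (n ≤ (ℓ * (3 * ℓ ∸ 1)) / 2) × (σmoex n % 2 ≡ 1))
  odd-in-interval (suc (suc l)) (s≤s (s≤s z≤n)) =
    let (n , lower , upper , odd-n) = odd-countParts-below-pentagonal l
    in  n , ≤-trans (≤-reflexive (interval-start l)) lower
          , ≤-trans upper (≤-reflexive (sym (pent⁻-closed-form (suc l))))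
          , odd⇒%2≡1 (σmoex n) (trans (odd-σmoex n) odd-n)

  unbounded : (m : ℕ) → ∃[ n ] ((m ≤ n) × (σmoex n % 2 ≡ 1))
  unbounded m =
    let (n , lower , _ , odd-n) = odd-in-interval (suc (suc m)) (s≤s (s≤s z≤n))
    in  n , ≤-trans (m≤n⇒m≤1+n (m≤m+n m _)) lower , odd-n
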